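{- Let $N$ be a homogeneous network with asymmetric inputs and $\tilde{N}$ its fundamental network. If $N$ is a lift of $\tilde{N}$, then $N$ is transitive.
   Context: A homogeneous network with asymmetric inputs has a finite cell set $C$, one cell type, $k$ edge types, each cell receiving exactly one edge of each type; it is represented by $\sigma_1,\dots,\sigma_k:C\to C$ (type-$i$ edge into $c$ comes from $\sigma_i(c)$). For such networks a network fibration $N\to N'$ is (determined by) a cell map $\varphi$ with $\varphi\circ\sigma_i=\sigma'_i\circ\varphi$ for all $i$. $N$ is transitive for a cell $c$ if for every cell $d$ there is a network fibration $\phi_d:N\to N$ with $\phi_d(c)=d$; $N$ is transitive if it is transitive for some cell. $N$ is a lift of $Q$ if $Q$ is a quotient network of $N$ (obtained from a balanced coloring), equivalently there is a surjective network fibration $N\to Q$. The fundamental network $\tilde{N}$ has as cells the semigroup $\tilde{C}$ of maps $C\to C$ generated under composition by $Id_C,\sigma_1,\dots,\sigma_k$, represented by $\tilde{\sigma}_i(\gamma)=\sigma_i\circ\gamma$. -}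

module Defs where

open import Data.Nat using (ℕ)
open import Data.Fin using (Fin)
open import Data.List using (List; []; _∷_)
open import Data.Product using (Σ; ∃; _×_)
open import Relation.Binary.PropositionalEquality using (_≡_)

-- A homogeneous network with asymmetric inputs on the finite cell set Fin n
-- with k edge types: σ i c is the source of the type-i edge into c.
Network : ℕ → ℕ → Set
Network n k = Fin k → Fin n → Fin n

IsFibration : {C C' : Set} {k : ℕ} →
  (Fin k → C → C) → (Fin k → C' → C') → (C → C') → Set
IsFibration {k = k} σ σ' φ = ∀ (i : Fin k) c → φ (σ i c) ≡ σ' i (φ c)

TransitiveFor : {n k : ℕ} → Network n k → Fin n → Set
TransitiveFor σ c = ∀ d → Σ _ λ φ → IsFibration σ σ φ × φ c ≡ d

Transitive : {n k : ℕ} → Network n k → Set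
Transitive σ = ∃ λ c → TransitiveFor σ c

-- Elements of the semigroup C̃ are exactly
-- the maps Fin n → Fin n (up to pointwise equality) of the form eval σ w.
eval : {n k : ℕ} → Network n k → List (Fin k) → Fin n → Fin n
eval σ []      x = x
eval σ (i ∷ w) x = σ i (eval σ w x)

_≗ᶜ_ : {n : ℕ} → (Fin n → Fin n) → (Fin n → Fin n) → Set
f ≗ᶜ g = ∀ x → f x ≡ g x

InFundamental : {n k : ℕ} → Network n k → (Fin n → Fin n) → Set
InFundamental σ γ = ∃ λ w → γ ≗ᶜ eval σ w

-- N is a lift of its fundamental network Ñ: there is a surjective network
-- fibration φ : N → Ñ, i.e. a cell map φ : C → C̃ with
-- φ ∘ σ_i = σ̃_i ∘ φ  where  σ̃_i γ = σ_i ∘ γ.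
IsLiftOfFundamental : {n k : ℕ} → Network n k → Set
IsLiftOfFundamental {n} {k} σ =
  Σ (Fin n → Fin n → Fin n) λ φ →
    (∀ c → InFundamental σ (φ c)) ×
    (∀ (i : Fin k) c → φ (σ i c) ≗ᶜ (λ x → σ i (φ c x))) ×
    (∀ γ → InFundamental σ γ → ∃ λ c → φ c ≗ᶜ γ)

-- A fibration φ : N → Ñ assigns to each cell c a map φ c : C → C with
-- φ (σᵢ c) = σᵢ ∘ φ c, so evaluating at any cell d is a fibration N → N.
-- Surjectivity provides a cell c₀ with φ c₀ = Id_C, and the evaluation
-- fibration at d then sends c₀ to d.
module Submission where

open import Defs
open import Data.Nat using (ℕ)
open import Data.Fin using (Fin)
open import Data.List using ([])
open import Data.Product using (_,_)
open import Relation.Binary.PropositionalEquality using (_≡_; refl)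

evaluation-isFibration :
  {C : Set} {k : ℕ} (σ : Fin k → C → C) (φ : C → C → C) →
  (∀ i c → ∀ x → φ (σ i c) x ≡ σ i (φ c x)) →
  ∀ d → IsFibration σ σ (λ c → φ c d)
evaluation-isFibration σ φ φ-fib d i c = φ-fib i c d

transitiveFor-preimageOfId :
  {n k : ℕ} (σ : Network n k) (φ : Fin n → Fin n → Fin n) →
  (∀ i c → φ (σ i c) ≗ᶜ (λ x → σ i (φ c x))) →
  ∀ c₀ → φ c₀ ≗ᶜ (λ x → x) → TransitiveFor σ c₀
transitiveFor-preimageOfId σ φ φ-fib c₀ φc₀≗id d =
  (λ c → φ c d) , evaluation-isFibration σ φ φ-fib d , φc₀≗id d

mainTheorem8 : (n k : ℕ) (σ : Network n k) → IsLiftOfFundamental σ → Transitive σ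
mainTheorem8 n k σ (φ , _ , φ-fib , φ-surj) with φ-surj (λ x → x) ([] , λ _ → refl)
... | c₀ , φc₀≗id = c₀ , transitiveFor-preimageOfId σ φ φ-fib c₀ φc₀≗id
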